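{- Let $X$ be a finite simplicial complex with vertices $v_1,\dots,v_m$, let $\varepsilon\in\mathbb{Z}_2^m$ be a dalmatian colouring, and let $b(\varepsilon)=\{r:\varepsilon(r)=1\}$. Then $$\mathrm{H}^h(X,\varepsilon)\cong\bigoplus_{r\in b(\varepsilon)}\mathbb{F}\langle v_r\rangle_{(0,0)}\;\oplus\bigoplus_{\substack{\sigma\subseteq X\\ \sigma\not\subseteq\bigcup_{r\in b(\varepsilon)}\overline{St(v_r)}}}\mathbb{F}\langle\sigma\rangle_{(\dim\sigma,\dim\sigma+1)},$$ where the second sum runs over the simplices $\sigma$ of $X$ not belonging to the closed star of any black vertex.
   Context: $\mathbb{F}$ is the field with two elements, $C_*(X)$ the simplicial chain complex of $X$ over $\mathbb{F}$ with basis the nonempty simplices. A colouring $\varepsilon\in\mathbb{Z}_2^m$ colours $v_i$ black if $\varepsilon(i)=1$ and white otherwise; the weight $w_\varepsilon(\sigma)$ is the number of white vertices of $\sigma$. The horizontal differential $\partial_h$ sends $\sigma$ to the sum of faces $\sigma\setminus\{v\}$ over black vertices $v\in\sigma$; it preserves weight and lowers dimension by one. $\mathrm{H}^h(X,\varepsilon)$ is the homology of $(C_*(X),\partial_h)$, bigraded by (dimension, weight). $\mathbb{F}\langle\sigma\rangle_{(a,b)}$ denotes a copy of $\mathbb{F}$ generated by (the class of) $\sigma$ in bidegree (dimension, weight) $=(a,b)$. The closed star $\overline{St(v)}$ of a vertex $v$ is the subcomplex consisting of all simplices containing $v$ together with all their faces. A colouring $\varepsilon\neq(0,\dots,0)$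 is dalmatian if for every pair of simplices $\sigma,\tau$ with $\sigma\cap\tau\neq\emptyset$, the vertex set of $\sigma\cup\tau$ contains at most one black vertex. -}

module Defs where

open import Data.Bool using (Bool; true; false; _∧_; _xor_; not; if_then_else_)
open import Data.Nat using (ℕ; zero; suc; _∸_; _≤_)
open import Data.Fin using (Fin)
open import Data.Fin.Subset using (Subset; ⁅_⁆; _∈_; _⊆_; _∩_; _∪_; _-_; ∣_∣; Nonempty)
open import Data.Fin.Subset.Properties using (_∈?_)
open import Data.Vec using (Vec; []; _∷_; tabulate; map)
open import Data.Vec.Properties using (≡-dec)
open import Data.List using (List; []; _∷_; _++_; foldr; allFin)
import Data.List as L
open import Data.Bool.Properties using () renaming (_≟_ to _≟B_)
open import Data.Product using (Σ; ∃; _×_; _,_)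
open import Data.Sum using (_⊎_)
open import Relation.Nullary using (¬_; Dec; yes; no)
open import Relation.Nullary.Decidable using (⌊_⌋)
open import Relation.Binary.PropositionalEquality using (_≡_)

allSubsets : (m : ℕ) → List (Subset m)
allSubsets zero    = [] ∷ []
allSubsets (suc m) = L.map (false ∷_) (allSubsets m) ++ L.map (true ∷_) (allSubsets m)

-- Sum over F = Z/2 (Bool with xor) of a list.
⊕ : List Bool → Bool
⊕ = foldr _xor_ false

_==_ : ∀ {m} → Subset m → Subset m → Bool
σ == τ = ⌊ ≡-dec _≟B_ σ τ ⌋

isEmptyᵇ : ∀ {m} → Subset m → Bool
isEmptyᵇ {m} σ = ⌊ Data.Nat._≟_ ∣ σ ∣ 0 ⌋

-- A finite simplicial complex on the vertex set {v_1,…,v_m} = Fin m.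
record Complex (m : ℕ) : Set where
  field
    simplex    : Subset m → Bool
    nonempty   : ∀ σ → simplex σ ≡ true → Nonempty σ
    vertices   : ∀ i → simplex ⁅ i ⁆ ≡ true
    downClosed : ∀ σ τ → simplex σ ≡ true → τ ⊆ σ → Nonempty τ → simplex τ ≡ true
open Complex public

-- A colouring ε ∈ Z₂^m: ε i = true means v_i is black (ε(i) = 1).
Colouring : ℕ → Set
Colouring m = Fin m → Bool

blackSet : ∀ {m} → Colouring m → Subset m
blackSet ε = tabulate ε

whiteSet : ∀ {m} → Colouring m → Subset m
whiteSet ε = tabulate (λ i → not (ε i))

dim : ∀ {m} → Subset m → ℕ
dim σ = ∣ σ ∣ ∸ 1

weight : ∀ {m} → Colouring m → Subset m → ℕ
weight ε σ = ∣ σ ∩ whiteSet ε ∣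

bideg : ∀ {m} → Colouring m → Subset m → ℕ × ℕ
bideg ε σ = dim σ , weight ε σ

Dalmatian : ∀ {m} → Complex m → Colouring m → Set
Dalmatian X ε =
  (¬ (∀ i → ε i ≡ false)) ×
  (∀ σ τ → simplex X σ ≡ true → simplex X τ ≡ true → Nonempty (σ ∩ τ) →
     ∣ (σ ∪ τ) ∩ blackSet ε ∣ ≤ 1)

Chain : ℕ → Set
Chain m = Subset m → Bool

IsChain : ∀ {m} → Complex m → Chain m → Set
IsChain X c = ∀ σ → c σ ≡ true → simplex X σ ≡ true

_≈_ : ∀ {m} → Chain m → Chain m → Set
c ≈ d = ∀ σ → c σ ≡ d σ

_+ᶜ_ : ∀ {m} → Chain m → Chain m → Chain m
(c +ᶜ d) σ = c σ xor d σ

0ᶜ : ∀ {m} → Chain m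
0ᶜ _ = false

δ : ∀ {m} → Subset m → Chain m
δ σ τ = σ == τ

-- horizontal differential on a basis simplex σ: sum of the faces σ ∖ {v}
-- over black vertices v ∈ σ (the empty face is omitted, since the basis
-- consists of nonempty simplices).
∂hσ : ∀ {m} → Colouring m → Subset m → Chain m
∂hσ {m} ε σ τ =
  ⊕ (L.map (λ v → ε v ∧ ⌊ v ∈? σ ⌋ ∧ not (isEmptyᵇ (σ - v)) ∧ ((σ - v) == τ)) (allFin m))

∂h : ∀ {m} → Colouring m → Chain m → Chain m
∂h {m} ε c τ = ⊕ (L.map (λ σ → c σ ∧ ∂hσ ε σ τ) (allSubsets m))

InClosedStar : ∀ {m} → Complex m → Fin m → Subset m → Set
InClosedStar X v σ = simplex X σ ≡ true × ∃ λ ρ → simplex X ρ ≡ true × v ∈ ρ × σ ⊆ ρ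

InBlackStars : ∀ {m} → Complex m → Colouring m → Subset m → Set
InBlackStars X ε σ = ∃ λ r → ε r ≡ true × InClosedStar X r σ

GenVertex : ∀ {m} → Colouring m → Subset m → Set
GenVertex ε σ = ∃ λ r → ε r ≡ true × σ ≡ ⁅ r ⁆

GenSimplex : ∀ {m} → Complex m → Colouring m → Subset m → Set
GenSimplex X ε σ = simplex X σ ≡ true × ¬ InBlackStars X ε σ

HomologyBasis : ∀ {m} → Complex m → Colouring m → (Subset m → Set) → Set
HomologyBasis X ε G =
  (∀ σ → G σ → simplex X σ ≡ true) ×
  (∀ σ → G σ → ∂h ε (δ σ) ≈ 0ᶜ) ×
  (∀ z → IsChain X z → ∂h ε z ≈ 0ᶜ →
     ∃ λ c → (∀ σ → c σ ≡ true → G σ) × ∃ λ b → IsChain X b × (z ≈ (c +ᶜ ∂h ε b))) ×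
  (∀ c → (∀ σ → c σ ≡ true → G σ) → ∀ b → IsChain X b → c ≈ ∂h ε b → c ≈ 0ᶜ)

-- Every simplex of X contains at most one black vertex, and two simplices of
-- X with a common nonempty face share their black vertex. Hence ∂h is a
-- partial matching on the basis: a simplex ρ with black vertex v and
-- ρ ≠ {v} is sent to its single face ρ ∖ v, and distinct such ρ have
-- distinct faces. The complex therefore splits into acyclic two-term pieces
-- ρ → ρ ∖ v plus the unmatched simplices, namely those with no black face
-- and no black coface in X: the black vertices, and the simplices lying in
-- no black closed star. Concretely, a cycle z differs from ∂h b, where b is
-- the chain of black cofaces of the simplices of z, by a chain supported on
-- unmatched simplices, while a boundary never involves an unmatched simplex.
module Submission where

open import Defs
open import Data.Nat using (ℕ; zero; suc; _∸_; _≤_; _<_; s≤s) renaming (_≟_ to _≟ⁿ_)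
open import Data.Nat.Properties using (≤-trans; <⇒≱)
open import Data.Bool using (Bool; true; false; _∧_; _xor_; not)
open import Data.Bool.Properties
  using (¬-not; not-injective; xor-assoc; xor-same; xor-identityʳ)
  renaming (_≟_ to _≟ᵇ_)
open import Data.Fin using (Fin) renaming (zero to fzero; suc to fsuc)
open import Data.Fin.Properties using (suc-injective; any?) renaming (_≟_ to _≟ᶠ_)
open import Data.Fin.Subset
  using (Subset; ⁅_⁆; _∈_; _∉_; _⊆_; _∩_; _∪_; _-_; _─_; ∣_∣; Nonempty; Empty; inside)
open import Data.Fin.Subset.Properties
  using ( _∈?_; x∈⁅x⁆; x∈⁅y⁆⇒x≡y; ∣⁅x⁆∣≡1; ⊆-antisym; p⊆q⇒∣p∣≤∣q∣; x∈p⇒∣p-x∣<∣p∣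
        ; x∈p∧x≢y⇒x∈p-y; p─q⊆p; x∈p∩q⁺; x∈p∩q⁻; p∩q⊆p; x∈p∪q⁺; x∈p∪q⁻
        ; nonempty?; Empty-unique; ∣⊥∣≡0)
open import Data.Vec using ([]; _∷_; tabulate; here; there)
open import Data.Vec.Properties
  using (≡-dec; ∷-injectiveˡ; ∷-injectiveʳ; lookup∘tabulate; []=⇒lookup; lookup⇒[]=)
open import Data.List using ([]; _∷_; _++_; allFin)
import Data.List as L
open import Data.List.Properties using (map-++; map-∘; map-tabulate)
open import Data.Product using (_×_; _,_; ∃; proj₁; proj₂)
open import Data.Sum using (_⊎_; inj₁; inj₂)
open import Function using (_∘_; id)
open import Relation.Nullary using (¬_; Dec; yes; no; contradiction)
open import Relation.Nullary.Decidable using (⌊_⌋; _×-dec_)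
open import Relation.Binary.PropositionalEquality
  using (_≡_; _≢_; refl; sym; trans; cong; cong₂; subst; module ≡-Reasoning)

private variable
  m n : ℕ
  A P : Set

∧-elim : ∀ {a b} → a ∧ b ≡ true → a ≡ true × b ≡ true
∧-elim {true} h = refl , h

∧-intro : ∀ {a b} → a ≡ true → b ≡ true → a ∧ b ≡ true
∧-intro refl refl = refl

xor-cancelʳ : ∀ a b → (a xor b) xor b ≡ a
xor-cancelʳ a b = begin
  (a xor b) xor b  ≡⟨ xor-assoc a b b ⟩
  a xor (b xor b)  ≡⟨ cong (a xor_) (xor-same b) ⟩
  a xor false      ≡⟨ xor-identityʳ a ⟩
  a                ∎
  where open ≡-Reasoning

⌊⌋-true⁺ : (p? : Dec P) → P → ⌊ p? ⌋ ≡ true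
⌊⌋-true⁺ (yes _)  _ = refl
⌊⌋-true⁺ (no ¬p) p = contradiction p ¬p

⌊⌋-true⁻ : (p? : Dec P) → ⌊ p? ⌋ ≡ true → P
⌊⌋-true⁻ (yes p) _ = p

⌊⌋-false⁺ : (p? : Dec P) → ¬ P → ⌊ p? ⌋ ≡ false
⌊⌋-false⁺ (yes p) ¬p = contradiction p ¬p
⌊⌋-false⁺ (no _)  _  = refl

⌊⌋-false⁻ : (p? : Dec P) → ⌊ p? ⌋ ≡ false → ¬ P
⌊⌋-false⁻ (no ¬p) _ = ¬p

SupportedAt : (A → Bool) → A → Set
SupportedAt f x = ∀ y → f y ≡ true → y ≡ x

off-support : ∀ {f : A → Bool} {x} → SupportedAt f x → ∀ y → y ≢ x → f y ≡ false
off-support supp y y≢x = ¬-not (y≢x ∘ supp y)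

⊕-map-true⇒∃ : ∀ (f : A → Bool) xs → ⊕ (L.map f xs) ≡ true → ∃ λ y → f y ≡ true
⊕-map-true⇒∃ f (x ∷ xs) h with f x in fx
... | true  = x , fx
... | false = ⊕-map-true⇒∃ f xs h

⊕-map-false : ∀ (f : A → Bool) xs → (∀ y → f y ≡ false) → ⊕ (L.map f xs) ≡ false
⊕-map-false f []       _    = refl
⊕-map-false f (x ∷ xs) f≡ff rewrite f≡ff x = ⊕-map-false f xs f≡ff

⊕-++ : ∀ xs ys → ⊕ (xs ++ ys) ≡ ⊕ xs xor ⊕ ys
⊕-++ []       ys = refl
⊕-++ (x ∷ xs) ys = trans (cong (x xor_) (⊕-++ xs ys)) (sym (xor-assoc x (⊕ xs) (⊕ ys)))

⊕-tabulate-supported : ∀ (f : Fin n → Bool) x → SupportedAt f x → ⊕ (L.tabulate f) ≡ f x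
⊕-tabulate-supported {suc n} f fzero supp = begin
  f fzero xor ⊕ (L.tabulate (f ∘ fsuc))
    ≡⟨ cong (λ xs → f fzero xor ⊕ xs) (map-tabulate id (f ∘ fsuc)) ⟨
  f fzero xor ⊕ (L.map (f ∘ fsuc) (allFin n))
    ≡⟨ cong (f fzero xor_) (⊕-map-false (f ∘ fsuc) (allFin n) λ y → off-support supp (fsuc y) λ ()) ⟩
  f fzero xor false
    ≡⟨ xor-identityʳ (f fzero) ⟩
  f fzero ∎
  where open ≡-Reasoning
⊕-tabulate-supported f (fsuc x) supp
  rewrite off-support supp fzero λ () =
  ⊕-tabulate-supported (f ∘ fsuc) x (λ y fy → suc-injective (supp (fsuc y) fy))

⊕-allFin-supported : ∀ (f : Fin n → Bool) x → SupportedAt f x → ⊕ (L.map f (allFin n)) ≡ f x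
⊕-allFin-supported f x supp rewrite map-tabulate id f = ⊕-tabulate-supported f x supp

⊕-allSubsets-suc : ∀ m (f : Subset (suc m) → Bool) →
  ⊕ (L.map f (allSubsets (suc m))) ≡
  ⊕ (L.map (f ∘ (false ∷_)) (allSubsets m)) xor ⊕ (L.map (f ∘ (true ∷_)) (allSubsets m))
⊕-allSubsets-suc m f = begin
  ⊕ (L.map f (L.map (false ∷_) S ++ L.map (true ∷_) S))
    ≡⟨ cong ⊕ (map-++ f (L.map (false ∷_) S) (L.map (true ∷_) S)) ⟩
  ⊕ (L.map f (L.map (false ∷_) S) ++ L.map f (L.map (true ∷_) S))
    ≡⟨ ⊕-++ (L.map f (L.map (false ∷_) S)) (L.map f (L.map (true ∷_) S)) ⟩
  ⊕ (L.map f (L.map (false ∷_) S)) xor ⊕ (L.map f (L.map (true ∷_) S))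
    ≡⟨ sym (cong₂ (λ xs ys → ⊕ xs xor ⊕ ys) (map-∘ S) (map-∘ S)) ⟩
  ⊕ (L.map (f ∘ (false ∷_)) S) xor ⊕ (L.map (f ∘ (true ∷_)) S) ∎
  where
  open ≡-Reasoning
  S = allSubsets m

⊕-allSubsets-supported : ∀ m (f : Subset m → Bool) x → SupportedAt f x →
  ⊕ (L.map f (allSubsets m)) ≡ f x
⊕-allSubsets-supported zero    f []      _    = xor-identityʳ (f [])
⊕-allSubsets-supported (suc m) f (s ∷ x) supp = trans (⊕-allSubsets-suc m f) (halves s supp)
  where
  matching-half : ∀ s → SupportedAt f (s ∷ x) → ⊕ (L.map (f ∘ (s ∷_)) (allSubsets m)) ≡ f (s ∷ x)
  matching-half s supp = ⊕-allSubsets-supported m (f ∘ (s ∷_)) x (λ y fy → ∷-injectiveʳ (supp _ fy))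

  other-half : ∀ s t → s ≢ t → SupportedAt f (s ∷ x) → ⊕ (L.map (f ∘ (t ∷_)) (allSubsets m)) ≡ false
  other-half s t s≢t supp =
    ⊕-map-false (f ∘ (t ∷_)) (allSubsets m) (λ y → off-support supp (t ∷ y) (s≢t ∘ sym ∘ ∷-injectiveˡ))

  halves : ∀ s → SupportedAt f (s ∷ x) →
    ⊕ (L.map (f ∘ (false ∷_)) (allSubsets m)) xor ⊕ (L.map (f ∘ (true ∷_)) (allSubsets m)) ≡ f (s ∷ x)
  halves false supp =
    trans (cong₂ _xor_ (matching-half false supp) (other-half false true (λ ()) supp)) (xor-identityʳ _)
  halves true  supp = cong₂ _xor_ (other-half true false (λ ()) supp) (matching-half true supp)

x∈p─q⇒x∉q : ∀ {x : Fin n} (p q : Subset n) → x ∈ p ─ q → x ∉ q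
x∈p─q⇒x∉q (_ ∷ p) (_      ∷ q) (there x∈p─q) (there x∈q) = x∈p─q⇒x∉q p q x∈p─q x∈q
x∈p─q⇒x∉q (_ ∷ p) (inside ∷ q) ()            here

x∈p-y⇒x≢y : ∀ {x y : Fin n} (p : Subset n) → x ∈ p - y → x ≢ y
x∈p-y⇒x≢y {y = y} p x∈p-y refl = x∈p─q⇒x∉q p ⁅ y ⁆ x∈p-y (x∈⁅x⁆ y)

x∈p-y⇒x∈p : ∀ {x y : Fin n} (p : Subset n) → x ∈ p - y → x ∈ p
x∈p-y⇒x∈p {y = y} p = p─q⊆p p ⁅ y ⁆

x∈p⇒⁅x⁆⊆p : ∀ {x : Fin n} {p} → x ∈ p → ⁅ x ⁆ ⊆ p
x∈p⇒⁅x⁆⊆p {x = x} x∈p y∈⁅x⁆ = subst (_∈ _) (sym (x∈⁅y⁆⇒x≡y x y∈⁅x⁆)) x∈p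

x∈p⇒0<∣p∣ : ∀ {x : Fin n} {p} → x ∈ p → 0 < ∣ p ∣
x∈p⇒0<∣p∣ {x = x} x∈p = subst (_≤ _) (∣⁅x⁆∣≡1 x) (p⊆q⇒∣p∣≤∣q∣ (x∈p⇒⁅x⁆⊆p x∈p))

Nonempty⇒∣p∣≢0 : ∀ {p : Subset n} → Nonempty p → ∣ p ∣ ≢ 0
Nonempty⇒∣p∣≢0 (_ , x∈p) ∣p∣≡0 with () ← subst (0 <_) ∣p∣≡0 (x∈p⇒0<∣p∣ x∈p)

∣p∣≢0⇒Nonempty : ∀ (p : Subset n) → ∣ p ∣ ≢ 0 → Nonempty p
∣p∣≢0⇒Nonempty {n} p ∣p∣≢0 with nonempty? p
... | yes ne = ne
... | no  em = contradiction (trans (cong ∣_∣ (Empty-unique em)) (∣⊥∣≡0 n)) ∣p∣≢0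

x∈p∧y∈p∧x≢y⇒2≤∣p∣ : ∀ {x y : Fin n} {p} → x ∈ p → y ∈ p → x ≢ y → 2 ≤ ∣ p ∣
x∈p∧y∈p∧x≢y⇒2≤∣p∣ x∈p y∈p x≢y =
  ≤-trans (s≤s (x∈p⇒0<∣p∣ (x∈p∧x≢y⇒x∈p-y y∈p (x≢y ∘ sym)))) (x∈p⇒∣p-x∣<∣p∣ x∈p)

Empty[p-x]⇒p⊆⁅x⁆ : ∀ {x : Fin n} {p} → Empty (p - x) → p ⊆ ⁅ x ⁆
Empty[p-x]⇒p⊆⁅x⁆ {x = x} empty {y} y∈p with y ≟ᶠ x
... | yes refl = x∈⁅x⁆ y
... | no  y≢x  = contradiction (y , x∈p∧x≢y⇒x∈p-y y∈p y≢x) empty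

Empty[⁅x⁆-x] : ∀ (x : Fin n) → Empty (⁅ x ⁆ - x)
Empty[⁅x⁆-x] x (y , y∈⁅x⁆-x) = x∈p-y⇒x≢y ⁅ x ⁆ y∈⁅x⁆-x (x∈⁅y⁆⇒x≡y x (x∈p-y⇒x∈p ⁅ x ⁆ y∈⁅x⁆-x))

p-x≡q-x⇒p≡q : ∀ {x : Fin n} {p q} → x ∈ p → x ∈ q → p - x ≡ q - x → p ≡ q
p-x≡q-x⇒p≡q {x = x} {p} {q} x∈p x∈q eq = ⊆-antisym (⊆-from x∈q eq) (⊆-from x∈p (sym eq))
  where
  ⊆-from : ∀ {r s} → x ∈ s → r - x ≡ s - x → r ⊆ s
  ⊆-from {r} {s} x∈s eq {y} y∈r with y ≟ᶠ x
  ... | yes refl = x∈s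
  ... | no  y≢x  = x∈p-y⇒x∈p s (subst (y ∈_) eq (x∈p∧x≢y⇒x∈p-y y∈r y≢x))

x∉p⇒[p∪⁅x⁆]-x≡p : ∀ {x : Fin n} {p} → x ∉ p → (p ∪ ⁅ x ⁆) - x ≡ p
x∉p⇒[p∪⁅x⁆]-x≡p {x = x} {p} x∉p = ⊆-antisym ⊆p p⊆
  where
  ⊆p : (p ∪ ⁅ x ⁆) - x ⊆ p
  ⊆p {y} y∈ with x∈p∪q⁻ p ⁅ x ⁆ (x∈p-y⇒x∈p (p ∪ ⁅ x ⁆) y∈)
  ... | inj₁ y∈p    = y∈p
  ... | inj₂ y∈⁅x⁆ = contradiction (x∈⁅y⁆⇒x≡y x y∈⁅x⁆) (x∈p-y⇒x≢y (p ∪ ⁅ x ⁆) y∈)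
  p⊆ : p ⊆ (p ∪ ⁅ x ⁆) - x
  p⊆ y∈p = x∈p∧x≢y⇒x∈p-y (x∈p∪q⁺ (inj₁ y∈p)) λ { refl → x∉p y∈p }

p⊆r∧x∈r⇒p∪⁅x⁆⊆r : ∀ {x : Fin n} {p r} → p ⊆ r → x ∈ r → p ∪ ⁅ x ⁆ ⊆ r
p⊆r∧x∈r⇒p∪⁅x⁆⊆r {p = p} p⊆r x∈r y∈ with x∈p∪q⁻ p _ y∈
... | inj₁ y∈p    = p⊆r y∈p
... | inj₂ y∈⁅x⁆ = x∈p⇒⁅x⁆⊆p x∈r y∈⁅x⁆

∈tabulate⁺ : ∀ (f : Fin n → Bool) {x} → f x ≡ true → x ∈ tabulate f
∈tabulate⁺ f {x} fx = lookup⇒[]= x (tabulate f) (trans (lookup∘tabulate f x) fx)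

∈tabulate⁻ : ∀ (f : Fin n → Bool) {x} → x ∈ tabulate f → f x ≡ true
∈tabulate⁻ f {x} x∈ = trans (sym (lookup∘tabulate f x)) ([]=⇒lookup x∈)

==-sound : ∀ (σ τ : Subset n) → (σ == τ) ≡ true → σ ≡ τ
==-sound σ τ = ⌊⌋-true⁻ (≡-dec _≟ᵇ_ σ τ)

==-refl : ∀ (σ : Subset n) → (σ == σ) ≡ true
==-refl σ = ⌊⌋-true⁺ (≡-dec _≟ᵇ_ σ σ) refl

nonEmptyᵇ-sound : ∀ (σ : Subset n) → not (isEmptyᵇ σ) ≡ true → Nonempty σ
nonEmptyᵇ-sound σ h = ∣p∣≢0⇒Nonempty σ (⌊⌋-false⁻ (∣ σ ∣ ≟ⁿ 0) (not-injective h))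

nonEmptyᵇ-complete : ∀ {σ : Subset n} → Nonempty σ → not (isEmptyᵇ σ) ≡ true
nonEmptyᵇ-complete {σ = σ} ne = cong not (⌊⌋-false⁺ (∣ σ ∣ ≟ⁿ 0) (Nonempty⇒∣p∣≢0 ne))

record BlackFace (ε : Colouring m) (ρ τ : Subset m) (v : Fin m) : Set where
  constructor blackFace
  field
    black    : ε v ≡ true
    vertex   : v ∈ ρ
    nonEmpty : Nonempty τ
    face     : ρ - v ≡ τ

AtMostOneBlack : Colouring m → Subset m → Set
AtMostOneBlack ε ρ = ∀ v w → ε v ≡ true → ε w ≡ true → v ∈ ρ → w ∈ ρ → v ≡ w

faceCoeff : Colouring m → Subset m → Subset m → Fin m → Bool
faceCoeff ε ρ τ v = ε v ∧ ⌊ v ∈? ρ ⌋ ∧ not (isEmptyᵇ (ρ - v)) ∧ ((ρ - v) == τ)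

faceCoeff≡true⇒BlackFace : ∀ {ε : Colouring m} ρ τ v →
  faceCoeff ε ρ τ v ≡ true → BlackFace ε ρ τ v
faceCoeff≡true⇒BlackFace ρ τ v h =
  let εv , h₁ = ∧-elim h; v∈ρ , h₂ = ∧-elim h₁; ne , eq = ∧-elim h₂
      ρ-v≡τ = ==-sound (ρ - v) τ eq
  in blackFace εv (⌊⌋-true⁻ (v ∈? ρ) v∈ρ) (subst Nonempty ρ-v≡τ (nonEmptyᵇ-sound (ρ - v) ne)) ρ-v≡τ

BlackFace⇒faceCoeff≡true : ∀ {ε : Colouring m} {ρ τ v} →
  BlackFace ε ρ τ v → faceCoeff ε ρ τ v ≡ true
BlackFace⇒faceCoeff≡true {ρ = ρ} {v = v} (blackFace εv v∈ρ ne refl) =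
  ∧-intro εv (∧-intro (⌊⌋-true⁺ (v ∈? ρ) v∈ρ) (∧-intro (nonEmptyᵇ-complete ne) (==-refl (ρ - v))))

BlackFace⇒face⊆ : ∀ {ε : Colouring m} {ρ τ v} → BlackFace ε ρ τ v → τ ⊆ ρ
BlackFace⇒face⊆ {ρ = ρ} (blackFace _ _ _ refl) = x∈p-y⇒x∈p ρ

BlackFace-unique : ∀ {ε : Colouring m} {ρ τ τ' v v'} → AtMostOneBlack ε ρ →
  BlackFace ε ρ τ v → BlackFace ε ρ τ' v' → v ≡ v' × τ ≡ τ'
BlackFace-unique one (blackFace εv v∈ρ _ refl) (blackFace εv' v'∈ρ _ refl)
  with refl ← one _ _ εv εv' v∈ρ v'∈ρ = refl , refl

∂hσ≡true⇒BlackFace : ∀ {ε : Colouring m} ρ τ → ∂hσ ε ρ τ ≡ true → ∃ (BlackFace ε ρ τ)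
∂hσ≡true⇒BlackFace {ε = ε} ρ τ h =
  let v , coeff = ⊕-map-true⇒∃ (faceCoeff ε ρ τ) (allFin _) h
  in v , faceCoeff≡true⇒BlackFace ρ τ v coeff

BlackFace⇒∂hσ≡true : ∀ {ε : Colouring m} {ρ τ v} → AtMostOneBlack ε ρ → BlackFace ε ρ τ v →
  ∂hσ ε ρ τ ≡ true
BlackFace⇒∂hσ≡true {ε = ε} {ρ} {τ} {v} one face =
  trans (⊕-allFin-supported (faceCoeff ε ρ τ) v supp) (BlackFace⇒faceCoeff≡true face)
  where
  supp : SupportedAt (faceCoeff ε ρ τ) v
  supp w coeff = proj₁ (BlackFace-unique one (faceCoeff≡true⇒BlackFace ρ τ w coeff) face)

∂h≡true⇒ : ∀ {ε : Colouring m} c τ → ∂h ε c τ ≡ true →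
  ∃ λ ρ → c ρ ≡ true × ∃ (BlackFace ε ρ τ)
∂h≡true⇒ {ε = ε} c τ h =
  let ρ , term = ⊕-map-true⇒∃ (λ ρ → c ρ ∧ ∂hσ ε ρ τ) (allSubsets _) h
      cρ , ∂ρ = ∧-elim term
  in ρ , cρ , ∂hσ≡true⇒BlackFace ρ τ ∂ρ

-- The transpose of ∂h: ∂hᵀ ε z ρ is the coefficient of ρ in the coboundary of z.
∂hᵀ : Colouring m → Chain m → Chain m
∂hᵀ {m} ε z ρ = ⊕ (L.map (λ τ → ∂hσ ε ρ τ ∧ z τ) (allSubsets m))

∂hᵀ≡true⇒ : ∀ {ε : Colouring m} z ρ → ∂hᵀ ε z ρ ≡ true →
  ∃ λ τ → z τ ≡ true × ∃ (BlackFace ε ρ τ)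
∂hᵀ≡true⇒ {ε = ε} z ρ h =
  let τ , term = ⊕-map-true⇒∃ (λ τ → ∂hσ ε ρ τ ∧ z τ) (allSubsets _) h
      ∂ρ , zτ = ∧-elim term
  in τ , zτ , ∂hσ≡true⇒BlackFace ρ τ ∂ρ

BlackFace⇒∂hᵀ≡true : ∀ {ε : Colouring m} {z ρ τ v} → AtMostOneBlack ε ρ → BlackFace ε ρ τ v →
  z τ ≡ true → ∂hᵀ ε z ρ ≡ true
BlackFace⇒∂hᵀ≡true {m} {ε} {z} {ρ} {τ} one face zτ =
  trans (⊕-allSubsets-supported m (λ τ → ∂hσ ε ρ τ ∧ z τ) τ supp)
        (∧-intro (BlackFace⇒∂hσ≡true one face) zτ)
  where
  supp : SupportedAt (λ τ → ∂hσ ε ρ τ ∧ z τ) τ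
  supp τ' term = let _ , face' = ∂hσ≡true⇒BlackFace ρ τ' (proj₁ (∧-elim term))
                 in sym (proj₂ (BlackFace-unique one face face'))

blackCofaces : Complex m → Colouring m → Chain m → Chain m
blackCofaces X ε z ρ = simplex X ρ ∧ ∂hᵀ ε z ρ

Generator : Complex m → Colouring m → Subset m → Set
Generator X ε σ = GenVertex ε σ ⊎ GenSimplex X ε σ

generator⇒simplex : ∀ (X : Complex m) ε σ → Generator X ε σ → simplex X σ ≡ true
generator⇒simplex X _ _ (inj₁ (r , _ , refl)) = vertices X r
generator⇒simplex _ _ _ (inj₂ (sσ , _))       = sσ

generator-hasNoBlackFace : ∀ {X : Complex m} {ε σ τ v} → Generator X ε σ → ¬ BlackFace ε σ τ v
generator-hasNoBlackFace (inj₁ (r , _ , refl)) (blackFace _ v∈⁅r⁆ ne refl)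
  with refl ← x∈⁅y⁆⇒x≡y r v∈⁅r⁆ = Empty[⁅x⁆-x] r ne
generator-hasNoBlackFace (inj₂ (sσ , outside)) (blackFace εv v∈σ _ _) =
  outside (_ , εv , sσ , _ , sσ , v∈σ , id)

unmatched⇒generator : ∀ {X : Complex m} {ε σ} → simplex X σ ≡ true →
  (∀ {τ v} → ¬ BlackFace ε σ τ v) →
  (∀ {ρ v} → simplex X ρ ≡ true → ¬ BlackFace ε ρ σ v) →
  Generator X ε σ
unmatched⇒generator {X = X} {ε} {σ} sσ noFace noCoface
  with any? (λ w → (ε w ≟ᵇ true) ×-dec (w ∈? σ))
... | yes (w , εw , w∈σ) = inj₁ (w , εw , ⊆-antisym σ⊆⁅w⁆ (x∈p⇒⁅x⁆⊆p w∈σ))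
  where
  σ⊆⁅w⁆ : σ ⊆ ⁅ w ⁆
  σ⊆⁅w⁆ = Empty[p-x]⇒p⊆⁅x⁆ λ ne → noFace (blackFace εw w∈σ ne refl)
... | no noBlack = inj₂ (sσ , notInBlackStars)
  where
  notInBlackStars : ¬ InBlackStars X ε σ
  notInBlackStars (v , εv , _ , ρ , sρ , v∈ρ , σ⊆ρ) =
    noCoface (downClosed X ρ (σ ∪ ⁅ v ⁆) sρ (p⊆r∧x∈r⇒p∪⁅x⁆⊆r σ⊆ρ v∈ρ) (v , v∈σ∪⁅v⁆))
             (blackFace εv v∈σ∪⁅v⁆ (nonempty X σ sσ) (x∉p⇒[p∪⁅x⁆]-x≡p λ v∈σ → noBlack (v , εv , v∈σ)))
    where
    v∈σ∪⁅v⁆ = x∈p∪q⁺ {p = σ} (inj₂ (x∈⁅x⁆ v))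

module _ (X : Complex m) (ε : Colouring m) (dal : Dalmatian X ε) where

  overlapping-simplices-shareBlack : ∀ {σ τ} → simplex X σ ≡ true → simplex X τ ≡ true →
    Nonempty (σ ∩ τ) → AtMostOneBlack ε (σ ∪ τ)
  overlapping-simplices-shareBlack {σ} {τ} sσ sτ meet v w εv εw v∈ w∈ with v ≟ᶠ w
  ... | yes v≡w = v≡w
  ... | no  v≢w = contradiction (proj₂ dal σ τ sσ sτ meet)
                    (<⇒≱ (x∈p∧y∈p∧x≢y⇒2≤∣p∣ (x∈p∩q⁺ (v∈ , ∈tabulate⁺ ε εv))
                                            (x∈p∩q⁺ (w∈ , ∈tabulate⁺ ε εw)) v≢w))

  simplex⇒atMostOneBlack : ∀ {ρ} → simplex X ρ ≡ true → AtMostOneBlack ε ρ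
  simplex⇒atMostOneBlack sρ v w εv εw v∈ρ w∈ρ =
    overlapping-simplices-shareBlack sρ sρ (v , x∈p∩q⁺ (v∈ρ , v∈ρ)) v w εv εw
      (x∈p∪q⁺ (inj₁ v∈ρ)) (x∈p∪q⁺ (inj₁ w∈ρ))

  blackCoface-unique : ∀ {ρ ρ' τ v v'} → simplex X ρ ≡ true → simplex X ρ' ≡ true →
    BlackFace ε ρ τ v → BlackFace ε ρ' τ v' → ρ ≡ ρ'
  blackCoface-unique sρ sρ' face@(blackFace εv v∈ρ (t , t∈τ) ρ-v≡τ)
                            face'@(blackFace εv' v'∈ρ' _ ρ'-v'≡τ)
    with refl ← overlapping-simplices-shareBlack sρ sρ'
                  (t , x∈p∩q⁺ (BlackFace⇒face⊆ face t∈τ , BlackFace⇒face⊆ face' t∈τ)) _ _ εv εv'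
                  (x∈p∪q⁺ (inj₁ v∈ρ)) (x∈p∪q⁺ (inj₂ v'∈ρ'))
    = p-x≡q-x⇒p≡q v∈ρ v'∈ρ' (trans ρ-v≡τ (sym ρ'-v'≡τ))

  BlackFace⇒∂h≡true : ∀ {c ρ τ v} → IsChain X c → c ρ ≡ true → BlackFace ε ρ τ v →
    ∂h ε c τ ≡ true
  BlackFace⇒∂h≡true {c} {ρ} {τ} cX cρ face =
    trans (⊕-allSubsets-supported m (λ ρ → c ρ ∧ ∂hσ ε ρ τ) ρ supp)
          (∧-intro cρ (BlackFace⇒∂hσ≡true (simplex⇒atMostOneBlack (cX ρ cρ)) face))
    where
    supp : SupportedAt (λ ρ → c ρ ∧ ∂hσ ε ρ τ) ρ
    supp ρ' term = let cρ' , ∂ρ' = ∧-elim term; _ , face' = ∂hσ≡true⇒BlackFace ρ' τ ∂ρ'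
                   in blackCoface-unique (cX ρ' cρ') (cX ρ cρ) face' face

  generator-hasNoBlackCoface : ∀ {σ ρ v} → simplex X ρ ≡ true → Generator X ε σ →
    ¬ BlackFace ε ρ σ v
  generator-hasNoBlackCoface {ρ = ρ} sρ (inj₁ (r , εr , refl)) (blackFace εv v∈ρ _ ρ-v≡⁅r⁆) =
    x∈p-y⇒x≢y ρ r∈ρ-v (simplex⇒atMostOneBlack sρ r _ εr εv (x∈p-y⇒x∈p ρ r∈ρ-v) v∈ρ)
    where r∈ρ-v = subst (r ∈_) (sym ρ-v≡⁅r⁆) (x∈⁅x⁆ r)
  generator-hasNoBlackCoface {ρ = ρ} sρ (inj₂ (sσ , outside)) (blackFace εv v∈ρ _ refl) =
    outside (_ , εv , sσ , ρ , sρ , v∈ρ , x∈p-y⇒x∈p ρ)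

  cycle-hasNoBlackFace : ∀ {z σ τ v} → IsChain X z → ∂h ε z ≈ 0ᶜ → z σ ≡ true →
    ¬ BlackFace ε σ τ v
  cycle-hasNoBlackFace {τ = τ} zX cycle zσ face
    with () ← trans (sym (BlackFace⇒∂h≡true zX zσ face)) (cycle τ)

  ∂h-blackCofaces⇒support : ∀ {z τ} → ∂h ε (blackCofaces X ε z) τ ≡ true → z τ ≡ true
  ∂h-blackCofaces⇒support {z} {τ} h =
    let ρ , bρ , v , face = ∂h≡true⇒ (blackCofaces X ε z) τ h
        sρ , ∂ᵀρ = ∧-elim bρ
        τ' , zτ' , v' , face' = ∂hᵀ≡true⇒ z ρ ∂ᵀρ
        τ'≡τ = proj₂ (BlackFace-unique (simplex⇒atMostOneBlack sρ) face' face)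
    in subst (λ τ → z τ ≡ true) τ'≡τ zτ'

  cofaced-support⇒∂h-blackCofaces : ∀ {z ρ τ v} → z τ ≡ true → simplex X ρ ≡ true →
    BlackFace ε ρ τ v → ∂h ε (blackCofaces X ε z) τ ≡ true
  cofaced-support⇒∂h-blackCofaces zτ sρ face =
    BlackFace⇒∂h≡true (λ ρ bρ → proj₁ (∧-elim bρ))
      (∧-intro sρ (BlackFace⇒∂hᵀ≡true (simplex⇒atMostOneBlack sρ) face zτ)) face

  cycle-residue-generator : ∀ {z} → IsChain X z → ∂h ε z ≈ 0ᶜ → ∀ τ →
    (z +ᶜ ∂h ε (blackCofaces X ε z)) τ ≡ true → Generator X ε τ
  cycle-residue-generator {z} zX cycle τ h with z τ in zτ | ∂h ε (blackCofaces X ε z) τ in ∂bτ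
  ... | true  | false =
    unmatched⇒generator {X = X} {ε} (zX τ zτ) (cycle-hasNoBlackFace zX cycle zτ) λ sρ face →
      contradiction (trans (sym (cofaced-support⇒∂h-blackCofaces zτ sρ face)) ∂bτ) λ ()
  ... | false | true  = contradiction (trans (sym (∂h-blackCofaces⇒support ∂bτ)) zτ) λ ()

  generators-span : ∀ z → IsChain X z → ∂h ε z ≈ 0ᶜ →
    ∃ λ c → (∀ σ → c σ ≡ true → Generator X ε σ) × ∃ λ b → IsChain X b × (z ≈ (c +ᶜ ∂h ε b))
  generators-span z zX cycle =
    z +ᶜ ∂h ε b , cycle-residue-generator zX cycle , b , (λ ρ bρ → proj₁ (∧-elim bρ)) ,
    λ τ → sym (xor-cancelʳ (z τ) (∂h ε b τ))
    where b = blackCofaces X ε z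

  generators-independent : ∀ c → (∀ σ → c σ ≡ true → Generator X ε σ) →
    ∀ b → IsChain X b → c ≈ ∂h ε b → c ≈ 0ᶜ
  generators-independent c cG b bX c≈∂b σ = ¬-not λ cσ →
    let ρ , bρ , _ , face = ∂h≡true⇒ {ε = ε} b σ (trans (sym (c≈∂b σ)) cσ)
    in generator-hasNoBlackCoface (bX ρ bρ) (cG σ cσ) face

generator-isCycle : ∀ (X : Complex m) ε σ → Generator X ε σ → ∂h ε (δ σ) ≈ 0ᶜ
generator-isCycle X ε σ g τ = ¬-not λ h →
  let ρ , σ==ρ , v , face = ∂h≡true⇒ {ε = ε} (δ σ) τ h
      σ≡ρ = ==-sound σ ρ σ==ρ
  in generator-hasNoBlackFace {X = X} g (subst (λ ρ → BlackFace ε ρ τ v) (sym σ≡ρ) face)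

bideg-blackVertex : ∀ {ε : Colouring m} σ → GenVertex ε σ → bideg ε σ ≡ (0 , 0)
bideg-blackVertex {m} {ε} _ (r , εr , refl) =
  cong₂ _,_ (cong (_∸ 1) (∣⁅x⁆∣≡1 r)) (trans (cong ∣_∣ (Empty-unique noWhite)) (∣⊥∣≡0 m))
  where
  noWhite : Empty (⁅ r ⁆ ∩ whiteSet ε)
  noWhite (x , x∈) with x∈⁅r⁆ , x∈white ← x∈p∩q⁻ ⁅ r ⁆ (whiteSet ε) x∈
                   with refl ← x∈⁅y⁆⇒x≡y r x∈⁅r⁆
    = contradiction (trans (sym (cong not εr)) (∈tabulate⁻ (not ∘ ε) x∈white)) λ ()

weight-allWhite : ∀ {ε : Colouring m} σ → (∀ {x} → x ∈ σ → ε x ≡ false) → weight ε σ ≡ ∣ σ ∣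
weight-allWhite {ε = ε} σ white =
  cong ∣_∣ (⊆-antisym (p∩q⊆p σ (whiteSet ε)) λ x∈σ →
    x∈p∩q⁺ (x∈σ , ∈tabulate⁺ (not ∘ ε) (cong not (white x∈σ))))

suc-dim : ∀ (σ : Subset m) → Nonempty σ → suc (dim σ) ≡ ∣ σ ∣
suc-dim σ (_ , x∈σ) with ∣ σ ∣ | x∈p⇒0<∣p∣ x∈σ
... | suc _ | _ = refl

bideg-outsideBlackStars : ∀ (X : Complex m) ε σ → GenSimplex X ε σ →
  bideg ε σ ≡ (dim σ , suc (dim σ))
bideg-outsideBlackStars X ε σ (sσ , outside) =
  cong (dim σ ,_) (trans (weight-allWhite σ white) (sym (suc-dim σ (nonempty X σ sσ))))
  where
  white : ∀ {x} → x ∈ σ → ε x ≡ false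
  white x∈σ = ¬-not λ εx → outside (_ , εx , sσ , σ , sσ , x∈σ , id)

proposition3p10 : ∀ {m} (X : Complex m) (ε : Colouring m) → Dalmatian X ε →
    HomologyBasis X ε (λ σ → GenVertex ε σ ⊎ GenSimplex X ε σ) ×
    (∀ σ → GenVertex ε σ → bideg ε σ ≡ (0 , 0)) ×
    (∀ σ → GenSimplex X ε σ → bideg ε σ ≡ (dim σ , suc (dim σ)))
proposition3p10 X ε dal =
  ( generator⇒simplex X ε
  , generator-isCycle X ε
  , generators-span X ε dal
  , generators-independent X ε dal )
  , bideg-blackVertex
  , bideg-outsideBlackStars X ε
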